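{- Let $k$ be a positive integer, $b=2k+1$, $N=\frac{b^3-1}{2}$ and $\mathbf{v}=(1,b,b^2)$. Let $\Pi_{N,\mathbf{v}}:=\{ (n \bmod N,\ nb \bmod N,\ nb^2 \bmod N) : 0 \leq n < N\}$ (residues in $\{0,\dots,N-1\}$) and $\lambda^{\ast}(\Pi_{N,\mathbf{v}}):=\min_{\mathbf{x}\neq\mathbf{y},\ \mathbf{x},\mathbf{y}\in\Pi_{N,\mathbf{v}}}\|\mathbf{x}-\mathbf{y}\|$ (Euclidean norm). Then $$ \lim_{k\rightarrow \infty} \frac{\lambda^{\ast}(\Pi_{N,\mathbf{v}})}{N^{2/3}} = 2^{1/6}. $$ -}

module Defs where

open import Data.Nat using (ℕ; zero; suc; _+_; _*_; _∸_; _^_; _⊓_; ∣_-_∣; _≟_)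
open import Data.Nat.DivMod using (_/_; _%_)
open import Data.Integer as ℤ using (ℤ; +_)
open import Data.List using (List; []; _∷_; upTo; concatMap; map; filter)
open import Data.Product using (_×_; _,_)
open import Data.Product.Properties using (≡-dec)
open import Relation.Nullary using (¬?)

bOf : ℕ → ℕ
bOf k = 2 * k + 1

NOf : ℕ → ℕ
NOf k = (bOf k ^ 3 ∸ 1) / 2

-- residue in {0,…,N-1}; the modulus-0 case never occurs (N ≥ 13 for k ≥ 1)
_mod′_ : ℕ → ℕ → ℕ
n mod′ zero  = n
n mod′ suc m = n % suc m

Point : Set
Point = ℕ × ℕ × ℕ

pt : ℕ → ℕ → Point
pt k n = (n mod′ NOf k , (n * bOf k) mod′ NOf k , (n * bOf k ^ 2) mod′ NOf k)

sqDist : Point → Point → ℕ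
sqDist (x₁ , x₂ , x₃) (y₁ , y₂ , y₃) =
  ∣ x₁ - y₁ ∣ ^ 2 + ∣ x₂ - y₂ ∣ ^ 2 + ∣ x₃ - y₃ ∣ ^ 2

_≟P_ : (x y : Point) → _
_≟P_ = ≡-dec _≟_ (≡-dec _≟_ _≟_)

allPairs : ℕ → List (Point × Point)
allPairs k = concatMap (λ i → map (λ j → (pt k i , pt k j)) (upTo (NOf k))) (upTo (NOf k))

distinctPairs : ℕ → List (Point × Point)
distinctPairs k = filter (λ { (x , y) → ¬? (x ≟P y) }) (allPairs k)

-- minimum of a list (0 for the empty list, which does not occur for k ≥ 1)
minimum : List ℕ → ℕ
minimum []       = 0
minimum (x ∷ xs) = go x xs
  where
  go : ℕ → List ℕ → ℕ
  go m []       = m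
  go m (y ∷ ys) = go (m ⊓ y) ys

lambdaStarSq : ℕ → ℕ
lambdaStarSq k = minimum (map (λ { (x , y) → sqDist x y }) (distinctPairs k))

{-# OPTIONS --safe #-}
module Submission where

-- Write b = 2k + 1 and M = b² + b + 1, so that N = kM. The difference of two points of Π is a
-- vector v = (x, y, z) of the lattice ℤ(1, b, b²) + Nℤ³. Its coordinate sum is Mσ, its consecutive
-- differences are x − y = kU and y − z = kW, and M divides U² + UW + W² =: Mτ; hence
--   3‖v‖² = (x + y + z)² + (x − y)² + (y − z)² + (z − x)² = M²σ² + 2k²M·τ,  τ ≥ 0.
-- If σ ≠ 0 and τ ≥ 1 this gives ‖v‖² ≥ 2k²M because M ≥ 4k²; if τ = 0 then x = y = z and 3 ∣ σ;
-- if σ = 0 then ‖v‖² is an integer multiple of 2k²M. The points of index k + 1 and 1 differ by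
-- (k, kb, −2k(k + 1)), of squared length exactly 2k²M. So λ*² = 2k²M, and
-- (λ*²)³ / N⁴ = 8k²/M = 2 − 2(6k + 3)/M → 2.

open import Defs
open import Data.Product using (Σ; ∃; ∃₂; _×_; _,_; proj₁; proj₂)
open import Data.Product.Properties using (,-injective)
open import Relation.Binary.PropositionalEquality
  using (_≡_; refl; cong; cong₂; sym; trans; subst; _≢_; module ≡-Reasoning)
open import Relation.Nullary using (Dec; yes; no; contradiction)

module Arithmetic where
  open import Data.Nat
  open import Data.Nat.Properties
  open import Data.Nat.Divisibility using (_∣_; ∣⇒≤)
  open import Data.Nat.DivMod using (_/_; m*n/n≡m)
  open import Data.Nat.Tactic.RingSolver using (solve-∀)

  -- M = b² + b + 1, so that b³ − 1 = 2kM and N = kM; INLINE lets the ring solver see the polynomial.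
  M : ℕ → ℕ
  M k = 3 + 6 * k + 4 * k * k
  {-# INLINE M #-}

  NOf≡k*M : ∀ k → NOf k ≡ k * M k
  NOf≡k*M k = begin
    (bOf k ^ 3 ∸ 1) / 2        ≡⟨ cong (λ c → (c ∸ 1) / 2) (cube k) ⟩
    (1 + k * M k * 2 ∸ 1) / 2  ≡⟨ cong (_/ 2) (m+n∸m≡n 1 (k * M k * 2)) ⟩
    k * M k * 2 / 2            ≡⟨ m*n/n≡m (k * M k) 2 ⟩
    k * M k                    ∎
    where
    open ≡-Reasoning
    cube : ∀ k → let b = 2 * k + 1 in b * (b * (b * 1)) ≡ 1 + k * M k * 2
    cube = solve-∀

  2[2k²M]≤M² : ∀ k → 2 * (2 * k * k * M k) ≤ M k * M k
  2[2k²M]≤M² k = begin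
    2 * (2 * k * k * M k)  ≡⟨ reassociate k ⟩
    4 * k * k * M k        ≤⟨ *-monoˡ-≤ (M k) (m≤n+m (4 * k * k) (3 + 6 * k)) ⟩
    M k * M k              ∎
    where
    open ≤-Reasoning
    reassociate : ∀ k → 2 * (2 * k * k * M k) ≡ 4 * k * k * M k
    reassociate = solve-∀

  bound-from-decomposition : ∀ {m c V s T} .{{_ : NonZero s}} → 2 * c ≤ m * m →
    3 * V ≡ m * m * (s * s) + c * T → (T ≡ 0 → 3 ∣ s) → c ≤ V
  bound-from-decomposition {m} {c} {V} {s} {suc T} 2c≤m² 3V≡ _ = *-cancelˡ-≤ 3 (begin
    3 * c                        ≡⟨ +-comm c (2 * c) ⟩
    2 * c + c                    ≤⟨ +-mono-≤ (≤-trans 2c≤m² (m≤m*n (m * m) (s * s) {{m*n≢0 s s}}))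
                                             (m≤m*n c (suc T)) ⟩
    m * m * (s * s) + c * suc T  ≡⟨ 3V≡ ⟨
    3 * V                        ∎)
    where open ≤-Reasoning
  bound-from-decomposition {m} {c} {V} {s} {zero} 2c≤m² 3V≡ 3∣s = *-cancelˡ-≤ 3 (begin
    3 * c                        ≤⟨ *-monoʳ-≤ 3 (≤-trans (m≤m+n c (c + 0)) 2c≤m²) ⟩
    3 * (m * m)                  ≡⟨ *-comm 3 (m * m) ⟩
    m * m * 3                    ≤⟨ *-monoʳ-≤ (m * m) (≤-trans (∣⇒≤ (3∣s refl)) (m≤m*n s s)) ⟩
    m * m * (s * s)              ≤⟨ m≤m+n (m * m * (s * s)) (c * 0) ⟩
    m * m * (s * s) + c * 0      ≡⟨ 3V≡ ⟨
    3 * V                        ∎)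
    where open ≤-Reasoning

  positive-definite : ∀ a w → a * a + 3 * (w * w) ≡ 0 → a ≡ 0 × w ≡ 0
  positive-definite zero    zero    _ = refl , refl
  positive-definite zero    (suc w) ()
  positive-definite (suc a) w       ()

  sqDist≡0⇒≡ : ∀ {p q} → sqDist p q ≡ 0 → p ≡ q
  sqDist≡0⇒≡ {x₁ , x₂ , x₃} {y₁ , y₂ , y₃} d≡0 =
    cong₂ _,_ (coordinate d₁≡0) (cong₂ _,_ (coordinate d₂≡0) (coordinate d₃≡0))
    where
    coordinate : ∀ {u v} → ∣ u - v ∣ ^ 2 ≡ 0 → u ≡ v
    coordinate d²≡0 = ∣m-n∣≡0⇒m≡n (m^n≡0⇒m≡0 _ 2 d²≡0)
    d₁+d₂≡0 : ∣ x₁ - y₁ ∣ ^ 2 + ∣ x₂ - y₂ ∣ ^ 2 ≡ 0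
    d₁+d₂≡0 = m+n≡0⇒m≡0 _ d≡0
    d₁≡0 : ∣ x₁ - y₁ ∣ ^ 2 ≡ 0
    d₁≡0 = m+n≡0⇒m≡0 _ d₁+d₂≡0
    d₂≡0 : ∣ x₂ - y₂ ∣ ^ 2 ≡ 0
    d₂≡0 = m+n≡0⇒n≡0 (∣ x₁ - y₁ ∣ ^ 2) d₁+d₂≡0
    d₃≡0 : ∣ x₃ - y₃ ∣ ^ 2 ≡ 0
    d₃≡0 = m+n≡0⇒n≡0 (∣ x₁ - y₁ ∣ ^ 2 + ∣ x₂ - y₂ ∣ ^ 2) d≡0

module Lattice where
  open import Agda.Builtin.FromNat using (Number; fromNat)
  open import Data.Unit using (tt)
  open import Data.Nat as ℕ using (ℕ; zero; suc; ≢-nonZero)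
  import Data.Nat.Properties as ℕ
  import Data.Nat.Divisibility as ℕ
  import Data.Nat.Literals as ℕ
  open import Data.Nat.DivMod using (_/_; _%_; m≡m%n+[m/n]*n)
  open import Data.Integer using (ℤ; +_; -[1+_]; -_; _+_; _-_; _*_; ∣_∣; _⊖_; _≟_)
  open import Data.Integer.Properties
    using ( [+m]-[+n]≡m⊖n; [1+m]⊖[1+n]≡m⊖n; pos-+; pos-*; +-injective; ∣i∣≡0⇒i≡0
          ; *-comm; *-assoc; *-cancelˡ-≡; +-0-abelianGroup)
  open import Data.Integer.Divisibility.Signed using (divides; ∣⇒∣ᵤ)
  open import Data.Integer.Literals using (number)
  open import Data.Integer.Tactic.RingSolver using (solve-∀)
  open import Algebra.Properties.AbelianGroup +-0-abelianGroup using (inverseˡ-unique)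
  open Arithmetic
    using (NOf≡k*M; 2[2k²M]≤M²; bound-from-decomposition; positive-definite; sqDist≡0⇒≡)
    renaming (M to Mℕ)

  -- With fromNat in scope every numeral is overloaded, so ℕ needs an instance as well; tt
  -- discharges the trivial constraint of these instances.
  instance
    ℕ-number : Number ℕ
    ℕ-number = ℕ.number
    ℤ-number : Number ℤ
    ℤ-number = number

  -- v = (x, y, z) = n (1, b, b²) + N (a₁, a₂, a₃) satisfies x + y + z = M σ, x − y = K U,
  -- y − z = K W, M τ = U² + U W + W² and 2x = M t − U. Every name is INLINE so that the
  -- ring solver sees the polynomial behind it.
  module LatticeVector (K n a₁ a₂ a₃ : ℤ) where
    b : ℤ
    b = 2 * K + 1
    {-# INLINE b #-}
    M : ℤ
    M = b * b + b + 1
    {-# INLINE M #-}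
    N : ℤ
    N = K * M
    {-# INLINE N #-}
    x : ℤ
    x = n + a₁ * N
    {-# INLINE x #-}
    y : ℤ
    y = n * b + a₂ * N
    {-# INLINE y #-}
    z : ℤ
    z = n * b * b + a₃ * N
    {-# INLINE z #-}
    ‖v‖² : ℤ
    ‖v‖² = x * x + y * y + z * z
    {-# INLINE ‖v‖² #-}
    p : ℤ
    p = a₁ - a₂
    {-# INLINE p #-}
    r : ℤ
    r = a₂ - a₃
    {-# INLINE r #-}
    σ : ℤ
    σ = n + K * (a₁ + a₂ + a₃)
    {-# INLINE σ #-}
    U : ℤ
    U = M * p - 2 * n
    {-# INLINE U #-}
    W : ℤ
    W = M * r - 2 * n * b
    {-# INLINE W #-}
    τ : ℤ
    τ = 4 * n * n - 2 * n * (2 * p + r + b * p + 2 * b * r) + M * (p * p + p * r + r * r)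
    {-# INLINE τ #-}
    t : ℤ
    t = p + 2 * K * a₁
    {-# INLINE t #-}
    ρ : ℤ
    ρ = M * (a₁ * a₁ + a₁ * a₂ + a₂ * a₂)
        - (a₁ + a₂ + a₃) * (2 * a₁ + b * a₁ + a₂ + 2 * b * a₂) + (a₁ + a₂ + a₃) * (a₁ + a₂ + a₃)
    {-# INLINE ρ #-}

  decomposition : ∀ K n a₁ a₂ a₃ → let open LatticeVector K n a₁ a₂ a₃ in
    3 * ‖v‖² ≡ M * M * (σ * σ) + 2 * K * K * M * τ
  decomposition = solve-∀

  eisenstein-norm : ∀ K n a₁ a₂ a₃ → let open LatticeVector K n a₁ a₂ a₃ in
    4 * M * τ ≡ (2 * U + W) * (2 * U + W) + 3 * (W * W)
  eisenstein-norm = solve-∀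

  diagonal : ∀ K n a₁ a₂ a₃ → let open LatticeVector K n a₁ a₂ a₃ in
    2 * M * σ ≡ 2 * M * ((σ - t) * 3) + (3 + 4 * K) * (2 * U + W) - 3 * W
  diagonal = solve-∀

  plane : ∀ K a₁ a₂ a₃ → let open LatticeVector K (- (K * (a₁ + a₂ + a₃))) a₁ a₂ a₃ in
    ‖v‖² ≡ 2 * K * K * M * ρ
  plane = solve-∀

  i*i≡+[∣i∣*∣i∣] : ∀ i → i * i ≡ + (∣ i ∣ ℕ.* ∣ i ∣)
  i*i≡+[∣i∣*∣i∣] (+ n)    = sym (pos-* n n)
  i*i≡+[∣i∣*∣i∣] -[1+ n ] = refl

  nonNegative-factor : ∀ {m q} (i : ℤ) → m ≢ 0 → + m * i ≡ + q → i ≡ + ∣ i ∣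
  nonNegative-factor {zero}  -[1+ _ ] m≢0 _ = contradiction refl m≢0
  nonNegative-factor {suc _} -[1+ _ ] _   ()
  nonNegative-factor         (+ _)    _   _ = refl

  +M≡M : ∀ k → let b = 2 * + k + 1 in + Mℕ k ≡ b * b + b + 1
  +M≡M k = begin
    + (3 ℕ.+ 6 ℕ.* k ℕ.+ 4 ℕ.* k ℕ.* k)    ≡⟨ pos-+ (3 ℕ.+ 6 ℕ.* k) (4 ℕ.* k ℕ.* k) ⟩
    + (3 ℕ.+ 6 ℕ.* k) + + (4 ℕ.* k ℕ.* k)  ≡⟨ cong₂ _+_ (pos-+ 3 (6 ℕ.* k)) (pos-* (4 ℕ.* k) k) ⟩
    3 + + (6 ℕ.* k) + + (4 ℕ.* k) * + k    ≡⟨ cong₂ (λ u v → 3 + u + v * + k) (pos-* 6 k) (pos-* 4 k) ⟩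
    3 + 6 * + k + 4 * + k * + k            ≡⟨ expand (+ k) ⟩
    (2 * + k + 1) * (2 * + k + 1) + (2 * + k + 1) + 1 ∎
    where
    open ≡-Reasoning
    expand : ∀ K → 3 + 6 * K + 4 * K * K ≡ (2 * K + 1) * (2 * K + 1) + (2 * K + 1) + 1
    expand = solve-∀

  module Decomposition (k : ℕ) (n a₁ a₂ a₃ : ℤ) where
    open LatticeVector (+ k) n a₁ a₂ a₃
    open ≡-Reasoning

    m c : ℕ
    m = Mℕ k
    c = 2 ℕ.* k ℕ.* k ℕ.* m

    M≡+m : M ≡ + m
    M≡+m = sym (+M≡M k)

    2K²M≡+c : 2 * + k * + k * M ≡ + c
    2K²M≡+c = begin
      2 * + k * + k * M        ≡⟨ cong (2 * + k * + k *_) M≡+m ⟩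
      2 * + k * + k * + m      ≡⟨ cong (λ u → u * + k * + m) (pos-* 2 k) ⟨
      + (2 ℕ.* k) * + k * + m  ≡⟨ cong (_* + m) (pos-* (2 ℕ.* k) k) ⟨
      + (2 ℕ.* k ℕ.* k) * + m  ≡⟨ pos-* (2 ℕ.* k ℕ.* k) m ⟨
      + c                      ∎

    σ≡0⇒‖v‖²≡ρc : σ ≡ 0 → ‖v‖² ≡ ρ * + c
    σ≡0⇒‖v‖²≡ρc σ≡0 = begin
      ‖v‖²
        ≡⟨ cong (λ n → LatticeVector.‖v‖² (+ k) n a₁ a₂ a₃) (inverseˡ-unique n _ σ≡0) ⟩
      LatticeVector.‖v‖² (+ k) (- (+ k * (a₁ + a₂ + a₃))) a₁ a₂ a₃
        ≡⟨ plane (+ k) a₁ a₂ a₃ ⟩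
      2 * + k * + k * M * ρ
        ≡⟨ cong (_* ρ) 2K²M≡+c ⟩
      + c * ρ
        ≡⟨ *-comm (+ c) ρ ⟩
      ρ * + c
        ∎

    a w : ℕ
    a = ∣ 2 * U + W ∣
    w = ∣ W ∣

    4mτ≡a²+3w² : + (4 ℕ.* m) * τ ≡ + (a ℕ.* a ℕ.+ 3 ℕ.* (w ℕ.* w))
    4mτ≡a²+3w² = begin
      + (4 ℕ.* m) * τ
        ≡⟨ cong (_* τ) (trans (pos-* 4 m) (cong (4 *_) (sym M≡+m))) ⟩
      4 * M * τ
        ≡⟨ eisenstein-norm (+ k) n a₁ a₂ a₃ ⟩
      (2 * U + W) * (2 * U + W) + 3 * (W * W)
        ≡⟨ cong₂ (λ u v → u + 3 * v) (i*i≡+[∣i∣*∣i∣] (2 * U + W)) (i*i≡+[∣i∣*∣i∣] W) ⟩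
      + (a ℕ.* a) + 3 * + (w ℕ.* w)
        ≡⟨ cong (_+_ (+ (a ℕ.* a))) (pos-* 3 (w ℕ.* w)) ⟨
      + (a ℕ.* a) + + (3 ℕ.* (w ℕ.* w))
        ≡⟨ pos-+ (a ℕ.* a) (3 ℕ.* (w ℕ.* w)) ⟨
      + (a ℕ.* a ℕ.+ 3 ℕ.* (w ℕ.* w))
        ∎

    τ≡+∣τ∣ : τ ≡ + ∣ τ ∣
    τ≡+∣τ∣ = nonNegative-factor {4 ℕ.* m} τ (λ ()) 4mτ≡a²+3w²

    4m∣τ∣≡a²+3w² : 4 ℕ.* m ℕ.* ∣ τ ∣ ≡ a ℕ.* a ℕ.+ 3 ℕ.* (w ℕ.* w)
    4m∣τ∣≡a²+3w² = +-injective (begin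
      + (4 ℕ.* m ℕ.* ∣ τ ∣)            ≡⟨ pos-* (4 ℕ.* m) ∣ τ ∣ ⟩
      + (4 ℕ.* m) * + ∣ τ ∣            ≡⟨ cong (+ (4 ℕ.* m) *_) τ≡+∣τ∣ ⟨
      + (4 ℕ.* m) * τ                  ≡⟨ 4mτ≡a²+3w² ⟩
      + (a ℕ.* a ℕ.+ 3 ℕ.* (w ℕ.* w))  ∎)

    3‖v‖²≡m²∣σ∣²+c∣τ∣ : 3 * ‖v‖² ≡ + (m ℕ.* m ℕ.* (∣ σ ∣ ℕ.* ∣ σ ∣) ℕ.+ c ℕ.* ∣ τ ∣)
    3‖v‖²≡m²∣σ∣²+c∣τ∣ = begin
      3 * ‖v‖²
        ≡⟨ decomposition (+ k) n a₁ a₂ a₃ ⟩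
      M * M * (σ * σ) + 2 * + k * + k * M * τ
        ≡⟨ cong₂ _+_ (cong₂ (λ u v → u * u * v) M≡+m (i*i≡+[∣i∣*∣i∣] σ)) (cong₂ _*_ 2K²M≡+c τ≡+∣τ∣) ⟩
      + m * + m * + (s ℕ.* s) + + c * + T
        ≡⟨ cong₂ _+_ (cong (_* + (s ℕ.* s)) (pos-* m m)) (pos-* c T) ⟨
      + (m ℕ.* m) * + (s ℕ.* s) + + (c ℕ.* T)
        ≡⟨ cong (_+ + (c ℕ.* T)) (pos-* (m ℕ.* m) (s ℕ.* s)) ⟨
      + (m ℕ.* m ℕ.* (s ℕ.* s)) + + (c ℕ.* T)
        ≡⟨ pos-+ (m ℕ.* m ℕ.* (s ℕ.* s)) (c ℕ.* T) ⟨
      + (m ℕ.* m ℕ.* (s ℕ.* s) ℕ.+ c ℕ.* T)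
        ∎
      where
      s T : ℕ
      s = ∣ σ ∣
      T = ∣ τ ∣

    -- τ = 0 forces U = W = 0, i.e. x = y = z; then 3x = Mσ and 2x = Mt give σ = 3(σ − t).
    ∣τ∣≡0⇒3∣∣σ∣ : ∣ τ ∣ ≡ 0 → 3 ℕ.∣ ∣ σ ∣
    ∣τ∣≡0⇒3∣∣σ∣ ∣τ∣≡0 = ∣⇒∣ᵤ (divides (σ - t) σ≡[σ-t]*3)
      where
      a≡0×w≡0 : a ≡ 0 × w ≡ 0
      a≡0×w≡0 = positive-definite a w (begin
        a ℕ.* a ℕ.+ 3 ℕ.* (w ℕ.* w)  ≡⟨ 4m∣τ∣≡a²+3w² ⟨
        4 ℕ.* m ℕ.* ∣ τ ∣            ≡⟨ cong (4 ℕ.* m ℕ.*_) ∣τ∣≡0 ⟩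
        4 ℕ.* m ℕ.* 0                ≡⟨ ℕ.*-zeroʳ (4 ℕ.* m) ⟩
        0                            ∎)
      2M≡+2m : 2 * M ≡ + (2 ℕ.* m)
      2M≡+2m = trans (cong (2 *_) M≡+m) (sym (pos-* 2 m))
      drop-zeros : ∀ X Y → X + Y * 0 - 3 * 0 ≡ X
      drop-zeros = solve-∀
      σ≡[σ-t]*3 : σ ≡ (σ - t) * 3
      σ≡[σ-t]*3 = *-cancelˡ-≡ (+ (2 ℕ.* m)) σ ((σ - t) * 3) (begin
        + (2 ℕ.* m) * σ
          ≡⟨ cong (_* σ) 2M≡+2m ⟨
        2 * M * σ
          ≡⟨ diagonal (+ k) n a₁ a₂ a₃ ⟩
        2 * M * ((σ - t) * 3) + (3 + 4 * + k) * (2 * U + W) - 3 * W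
          ≡⟨ cong₂ (λ A W → 2 * M * ((σ - t) * 3) + (3 + 4 * + k) * A - 3 * W)
                   (∣i∣≡0⇒i≡0 (proj₁ a≡0×w≡0)) (∣i∣≡0⇒i≡0 (proj₂ a≡0×w≡0)) ⟩
        2 * M * ((σ - t) * 3) + (3 + 4 * + k) * 0 - 3 * 0
          ≡⟨ drop-zeros (2 * M * ((σ - t) * 3)) (3 + 4 * + k) ⟩
        2 * M * ((σ - t) * 3)
          ≡⟨ cong (_* ((σ - t) * 3)) 2M≡+2m ⟩
        + (2 ℕ.* m) * ((σ - t) * 3)
          ∎)

  lattice-minimum : ∀ k n a₁ a₂ a₃ {V} → + V ≡ LatticeVector.‖v‖² (+ k) n a₁ a₂ a₃ →
    V ≢ 0 → 2 ℕ.* k ℕ.* k ℕ.* Mℕ k ℕ.≤ V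
  lattice-minimum k n a₁ a₂ a₃ {V} V≡‖v‖² V≢0 = by-cases (σ ≟ 0)
    where
    open LatticeVector (+ k) n a₁ a₂ a₃
    open Decomposition k n a₁ a₂ a₃
    by-cases : Dec (σ ≡ 0) → c ℕ.≤ V
    by-cases (yes σ≡0) =
      ℕ.∣⇒≤ {{≢-nonZero V≢0}} (∣⇒∣ᵤ (divides ρ (trans V≡‖v‖² (σ≡0⇒‖v‖²≡ρc σ≡0))))
    by-cases (no σ≢0)  = bound-from-decomposition {m} {c} {V} {∣ σ ∣} {∣ τ ∣}
      {{≢-nonZero (λ ∣σ∣≡0 → σ≢0 (∣i∣≡0⇒i≡0 ∣σ∣≡0))}} (2[2k²M]≤M² k)
      (+-injective (trans (pos-* 3 V) (trans (cong (3 *_) V≡‖v‖²) 3‖v‖²≡m²∣σ∣²+c∣τ∣)))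
      ∣τ∣≡0⇒3∣∣σ∣

  ∣m⊖n∣≡∣m-n∣ : ∀ m n → ∣ m ⊖ n ∣ ≡ ℕ.∣ m - n ∣
  ∣m⊖n∣≡∣m-n∣ zero    zero    = refl
  ∣m⊖n∣≡∣m-n∣ zero    (suc n) = refl
  ∣m⊖n∣≡∣m-n∣ (suc m) zero    = refl
  ∣m⊖n∣≡∣m-n∣ (suc m) (suc n) =
    trans (cong ∣_∣ ([1+m]⊖[1+n]≡m⊖n m n)) (∣m⊖n∣≡∣m-n∣ m n)

  ∣[+m]-[+n]∣≡∣m-n∣ : ∀ m n → ∣ + m - + n ∣ ≡ ℕ.∣ m - n ∣
  ∣[+m]-[+n]∣≡∣m-n∣ m n = trans (cong ∣_∣ ([+m]-[+n]≡m⊖n m n)) (∣m⊖n∣≡∣m-n∣ m n)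

  ∣+m-+[m+n]∣≡n : ∀ m n → ∣ + m - + (m ℕ.+ n) ∣ ≡ n
  ∣+m-+[m+n]∣≡n m n = trans (∣[+m]-[+n]∣≡∣m-n∣ m (m ℕ.+ n)) (ℕ.∣m-m+n∣≡n m n)

  +[∣m-n∣²]≡[+m-+n]² : ∀ m n → + (ℕ.∣ m - n ∣ ℕ.^ 2) ≡ (+ m - + n) * (+ m - + n)
  +[∣m-n∣²]≡[+m-+n]² m n = begin
    + (d ℕ.* (d ℕ.* 1))                  ≡⟨ cong (λ e → + (d ℕ.* e)) (ℕ.*-identityʳ d) ⟩
    + (d ℕ.* d)                          ≡⟨ cong (λ e → + (e ℕ.* e)) (∣[+m]-[+n]∣≡∣m-n∣ m n) ⟨
    + (∣ + m - + n ∣ ℕ.* ∣ + m - + n ∣)  ≡⟨ i*i≡+[∣i∣*∣i∣] (+ m - + n) ⟨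
    (+ m - + n) * (+ m - + n)            ∎
    where
    open ≡-Reasoning
    d : ℕ
    d = ℕ.∣ m - n ∣

  +[m%n]≡+m-+[m/n]*+n : ∀ m n .{{_ : ℕ.NonZero n}} → + (m % n) ≡ + m - + (m / n) * + n
  +[m%n]≡+m-+[m/n]*+n m n = begin
    + (m % n)                                      ≡⟨ shift (+ (m % n)) (+ (m / n)) (+ n) ⟩
    + (m % n) + + (m / n) * + n - + (m / n) * + n  ≡⟨ cong (λ u → u - + (m / n) * + n) +m≡ ⟨
    + m - + (m / n) * + n                          ∎
    where
    open ≡-Reasoning
    shift : ∀ r q N → r ≡ r + q * N - q * N
    shift = solve-∀
    +m≡ : + m ≡ + (m % n) + + (m / n) * + n
    +m≡ = trans (cong +_ (m≡m%n+[m/n]*n m n))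
                (trans (pos-+ (m % n) (m / n ℕ.* n)) (cong (_+_ (+ (m % n))) (pos-* (m / n) n)))

  mod′≡% : ∀ m n .{{_ : ℕ.NonZero n}} → m mod′ n ≡ m % n
  mod′≡% m (suc n) = refl

  +[∣m-n∣²]-mod′ : ∀ m n N .{{_ : ℕ.NonZero N}} {d N′ : ℤ} → + m - + n ≡ d → + N ≡ N′ →
    + (ℕ.∣ m mod′ N - n mod′ N ∣ ℕ.^ 2) ≡
      (d + (+ (n / N) - + (m / N)) * N′) * (d + (+ (n / N) - + (m / N)) * N′)
  +[∣m-n∣²]-mod′ m n N {d} {N′} m-n≡d N≡N′ = begin
    + (ℕ.∣ m mod′ N - n mod′ N ∣ ℕ.^ 2)
      ≡⟨ cong₂ (λ u v → + (ℕ.∣ u - v ∣ ℕ.^ 2)) (mod′≡% m N) (mod′≡% n N) ⟩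
    + (ℕ.∣ m % N - n % N ∣ ℕ.^ 2)
      ≡⟨ +[∣m-n∣²]≡[+m-+n]² (m % N) (n % N) ⟩
    (+ (m % N) - + (n % N)) * (+ (m % N) - + (n % N))
      ≡⟨ cong (λ u → u * u) difference ⟩
    (d + q * N′) * (d + q * N′)
      ∎
    where
    open ≡-Reasoning
    q : ℤ
    q = + (n / N) - + (m / N)
    regroup : ∀ A C a c N → (A - a * N) - (C - c * N) ≡ (A - C) + (c - a) * N
    regroup = solve-∀
    difference : + (m % N) - + (n % N) ≡ d + q * N′
    difference = begin
      + (m % N) - + (n % N)
        ≡⟨ cong₂ _-_ (+[m%n]≡+m-+[m/n]*+n m N) (+[m%n]≡+m-+[m/n]*+n n N) ⟩
      (+ m - + (m / N) * + N) - (+ n - + (n / N) * + N)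
        ≡⟨ regroup (+ m) (+ n) (+ (m / N)) (+ (n / N)) (+ N) ⟩
      (+ m - + n) + q * + N
        ≡⟨ cong₂ (λ u v → u + q * v) m-n≡d N≡N′ ⟩
      d + q * N′
        ∎

  +b≡b : ∀ k → + bOf k ≡ 2 * + k + 1
  +b≡b k = trans (pos-+ (2 ℕ.* k) 1) (cong (_+ 1) (pos-* 2 k))

  +N≡N : ∀ k → let b = 2 * + k + 1 in + NOf k ≡ + k * (b * b + b + 1)
  +N≡N k = trans (cong +_ (NOf≡k*M k)) (trans (pos-* k (Mℕ k)) (cong (+ k *_) (+M≡M k)))

  +[i*c]-+[j*c] : ∀ i j c → + (i ℕ.* c) - + (j ℕ.* c) ≡ (+ i - + j) * + c
  +[i*c]-+[j*c] i j c = trans (cong₂ _-_ (pos-* i c) (pos-* j c)) (factor (+ i) (+ j) (+ c))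
    where
    factor : ∀ I J C → I * C - J * C ≡ (I - J) * C
    factor = solve-∀

  pt-difference : ∀ k i j .{{_ : ℕ.NonZero (NOf k)}} → ∃ λ a₁ → ∃ λ a₂ → ∃ λ a₃ →
    + sqDist (pt k i) (pt k j) ≡ LatticeVector.‖v‖² (+ k) (+ i - + j) a₁ a₂ a₃
  pt-difference k i j = a₁ , a₂ , a₃ ,
    trans (pos-+ (dx ℕ.+ dy) dz) (cong₂ _+_ (trans (pos-+ dx dy) (cong₂ _+_ x² y²)) z²)
    where
    Nₖ bₖ : ℕ
    Nₖ = NOf k
    bₖ = bOf k
    n a₁ a₂ a₃ : ℤ
    n  = + i - + j
    a₁ = + (j / Nₖ) - + (i / Nₖ)
    a₂ = + (j ℕ.* bₖ / Nₖ) - + (i ℕ.* bₖ / Nₖ)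
    a₃ = + (j ℕ.* bₖ ℕ.^ 2 / Nₖ) - + (i ℕ.* bₖ ℕ.^ 2 / Nₖ)
    open LatticeVector (+ k) n a₁ a₂ a₃ using (x; y; z)
    dx dy dz : ℕ
    dx = ℕ.∣ i mod′ Nₖ - j mod′ Nₖ ∣ ℕ.^ 2
    dy = ℕ.∣ (i ℕ.* bₖ) mod′ Nₖ - (j ℕ.* bₖ) mod′ Nₖ ∣ ℕ.^ 2
    dz = ℕ.∣ (i ℕ.* bₖ ℕ.^ 2) mod′ Nₖ - (j ℕ.* bₖ ℕ.^ 2) mod′ Nₖ ∣ ℕ.^ 2
    +bₖ²≡b*b : + (bₖ ℕ.^ 2) ≡ (2 * + k + 1) * (2 * + k + 1)
    +bₖ²≡b*b = trans (cong (λ e → + (bₖ ℕ.* e)) (ℕ.*-identityʳ bₖ))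
                     (trans (pos-* bₖ bₖ) (cong₂ _*_ (+b≡b k) (+b≡b k)))
    x² : + dx ≡ x * x
    x² = +[∣m-n∣²]-mod′ i j Nₖ refl (+N≡N k)
    y² : + dy ≡ y * y
    y² = +[∣m-n∣²]-mod′ (i ℕ.* bₖ) (j ℕ.* bₖ) Nₖ
           (trans (+[i*c]-+[j*c] i j bₖ) (cong (n *_) (+b≡b k))) (+N≡N k)
    z² : + dz ≡ z * z
    z² = +[∣m-n∣²]-mod′ (i ℕ.* bₖ ℕ.^ 2) (j ℕ.* bₖ ℕ.^ 2) Nₖ
           (trans (+[i*c]-+[j*c] i j (bₖ ℕ.^ 2)) (trans (cong (n *_) +bₖ²≡b*b) (sym (*-assoc n _ _))))
           (+N≡N k)

  points-far-apart : ∀ k i j .{{_ : ℕ.NonZero (NOf k)}} → pt k i ≢ pt k j →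
    2 ℕ.* k ℕ.* k ℕ.* Mℕ k ℕ.≤ sqDist (pt k i) (pt k j)
  points-far-apart k i j pᵢ≢pⱼ with pt-difference k i j
  ... | a₁ , a₂ , a₃ , eq =
    lattice-minimum k (+ i - + j) a₁ a₂ a₃ eq (λ d≡0 → pᵢ≢pⱼ (sqDist≡0⇒≡ d≡0))

open Arithmetic
open Lattice using (points-far-apart; ∣+m-+[m+n]∣≡n)

open import Data.Nat using (ℕ; _≤_; _<_; _^_; _*_)
open import Data.Integer as ℤ using (ℤ; +_; ∣_∣)
open import Data.Nat using (suc; _+_; _⊓_; ∣_-_∣; NonZero; >-nonZero; ≢-nonZero⁻¹)
open import Data.Nat.Properties
open import Data.Nat.DivMod using (m<n⇒m%n≡m; [m+n]%n≡m%n)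
open import Data.Nat.Tactic.RingSolver using (solve-∀)
open import Data.List using ([]; _∷_; map; upTo)
open import Data.List.Relation.Unary.Any using (here; there)
open import Data.List.Membership.Propositional using (_∈_; find; lose)
open import Data.List.Membership.Propositional.Properties
  using (∈-map⁺; ∈-map⁻; ∈-filter⁺; ∈-filter⁻; ∈-concatMap⁺; ∈-concatMap⁻; ∈-upTo⁺)
open import Function using (case_of_)

minimum≤ : ∀ {x d} xs → d ∈ x ∷ xs → minimum (x ∷ xs) ≤ d
minimum≤     []       (here refl)         = ≤-refl
minimum≤ {x} (y ∷ ys) (here refl)         = ≤-trans (minimum≤ ys (here refl)) (m⊓n≤m x y)
minimum≤ {x} (y ∷ ys) (there (here refl)) = ≤-trans (minimum≤ ys (here refl)) (m⊓n≤n x y)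
minimum≤ {x} (y ∷ ys) (there (there d∈))  = minimum≤ {x ⊓ y} ys (there d∈)

≤minimum : ∀ {L x} xs → (∀ {d} → d ∈ x ∷ xs → L ≤ d) → L ≤ minimum (x ∷ xs)
≤minimum         []       L≤ = L≤ (here refl)
≤minimum {L} {x} (y ∷ ys) L≤ = ≤minimum ys L≤x⊓y∷ys
  where
  L≤x⊓y∷ys : ∀ {d} → d ∈ x ⊓ y ∷ ys → L ≤ d
  L≤x⊓y∷ys (here refl) = ⊓-glb (L≤ (here refl)) (L≤ (there (here refl)))
  L≤x⊓y∷ys (there d∈)  = L≤ (there (there d∈))

minimum-≡ : ∀ {L} xs → L ∈ xs → (∀ {d} → d ∈ xs → L ≤ d) → minimum xs ≡ L
minimum-≡ (x ∷ xs) L∈ L≤ = ≤-antisym (minimum≤ xs L∈) (≤minimum xs L≤)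

minimum-map-≡ : ∀ {A : Set} (f : A → ℕ) {xs a L} → a ∈ xs → f a ≡ L →
  (∀ {a} → a ∈ xs → L ≤ f a) → minimum (map f xs) ≡ L
minimum-map-≡ f {xs} a∈ fa≡L L≤ = minimum-≡ (map f xs) (subst (_∈ map f xs) fa≡L (∈-map⁺ f a∈))
  λ d∈ → case ∈-map⁻ f d∈ of λ { (a , a∈ , refl) → L≤ a∈ }

∈-distinctPairs⁻ : ∀ k {p q} → (p , q) ∈ distinctPairs k →
  ∃₂ λ i j → p ≡ pt k i × q ≡ pt k j × p ≢ q
∈-distinctPairs⁻ k pq∈ with ∈-filter⁻ _ {xs = allPairs k} pq∈
... | pq∈all , p≢q with find (∈-concatMap⁻ _ {xs = upTo (NOf k)} pq∈all)
... | i , _ , pq∈row with ∈-map⁻ _ pq∈row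
... | j , _ , pq≡ = i , j , proj₁ (,-injective pq≡) , proj₂ (,-injective pq≡) , p≢q

∈-distinctPairs⁺ : ∀ k {i j} → i < NOf k → j < NOf k → pt k i ≢ pt k j →
  (pt k i , pt k j) ∈ distinctPairs k
∈-distinctPairs⁺ k {i} i<N j<N pᵢ≢pⱼ = ∈-filter⁺ _ {xs = allPairs k} pair∈allPairs pᵢ≢pⱼ
  where
  pair∈allPairs : (pt k i , pt k _) ∈ allPairs k
  pair∈allPairs = ∈-concatMap⁺ _ {xs = upTo (NOf k)}
    (lose (∈-upTo⁺ i<N) (∈-map⁺ (λ j → (pt k i , pt k j)) (∈-upTo⁺ j<N)))

NOf-nonZero : ∀ k .{{_ : NonZero k}} → NonZero (NOf k)
NOf-nonZero k = subst NonZero (sym (NOf≡k*M k)) (m*n≢0 k (M k))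

distinctPairs-far-apart : ∀ k .{{_ : NonZero k}} {p q} → (p , q) ∈ distinctPairs k →
  2 * k * k * M k ≤ sqDist p q
distinctPairs-far-apart k pq∈ with ∈-distinctPairs⁻ k pq∈
... | i , j , refl , refl , pᵢ≢pⱼ = points-far-apart k i j {{NOf-nonZero k}} pᵢ≢pⱼ

mod′-small : ∀ {m n} → m < n → m mod′ n ≡ m
mod′-small {n = suc _} m<n = m<n⇒m%n≡m m<n

mod′-wrap : ∀ {m n} → m < n → (m + n) mod′ n ≡ m
mod′-wrap {m} {suc n} m<n = trans ([m+n]%n≡m%n m (suc n)) (m<n⇒m%n≡m m<n)

b²<N : ∀ k .{{_ : NonZero k}} → bOf k * bOf k < NOf k
b²<N (suc k) = begin-strict
  b * b                                                    <⟨ m≤m+n (suc (b * b)) _ ⟩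
  suc (b * b) + (4 * k * k * k + 14 * k * k + 15 * k + 3)  ≡⟨ expand k ⟨
  suc k * M (suc k)                                        ≡⟨ NOf≡k*M (suc k) ⟨
  NOf (suc k)                                              ∎
  where
  open ≤-Reasoning
  b : ℕ
  b = bOf (suc k)
  expand : ∀ k → let b = 2 * suc k + 1 in
    suc k * M (suc k) ≡ suc (b * b) + (4 * k * k * k + 14 * k * k + 15 * k + 3)
  expand = solve-∀

-- (k + 1)b² = c + N, so pt (k + 1) − pt 1 = (k, kb, c − b²) = (k, kb, −e).
module ClosestPair (k : ℕ) .{{_ : NonZero k}} where
  b N c e : ℕ
  b = bOf k
  N = NOf k
  c = 2 * k * k + 2 * k + 1
  e = 2 * k * k + 2 * k

  b*b≡c+e : b * b ≡ c + e
  b*b≡c+e = expand k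
    where
    expand : ∀ k → (2 * k + 1) * (2 * k + 1) ≡ 2 * k * k + 2 * k + 1 + (2 * k * k + 2 * k)
    expand = solve-∀

  [1+k]b²≡c+N : suc k * b ^ 2 ≡ c + N
  [1+k]b²≡c+N = trans (expand k) (cong (_+_ c) (sym (NOf≡k*M k)))
    where
    expand : ∀ k → let b = 2 * k + 1 in suc k * (b * (b * 1)) ≡ 2 * k * k + 2 * k + 1 + k * M k
    expand = solve-∀

  1≤b : 1 ≤ b
  1≤b = m≤n+m 1 (2 * k)

  1+k≤b : suc k ≤ b
  1+k≤b = ≤-trans (m≤m+n (suc k) k) (≤-reflexive (expand k))
    where
    expand : ∀ k → suc k + k ≡ 2 * k + 1
    expand = solve-∀

  instance
    b-nonZero : NonZero b
    b-nonZero = >-nonZero 1≤b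

  b≤b*b : b ≤ b * b
  b≤b*b = m≤m*n b b

  small : ∀ {m} → m ≤ b * b → m < N
  small m≤b² = ≤-<-trans m≤b² (b²<N k)

  pt-1 : pt k 1 ≡ (1 , b , b * b)
  pt-1 = cong₂ _,_ (mod′-small (small (≤-trans 1≤b b≤b*b)))
           (cong₂ _,_ (trans (cong (_mod′ N) (*-identityˡ b)) (mod′-small (small b≤b*b)))
                      (trans (cong (_mod′ N) 1*b²≡b*b) (mod′-small (small ≤-refl))))
    where
    1*b²≡b*b : 1 * b ^ 2 ≡ b * b
    1*b²≡b*b = trans (*-identityˡ (b ^ 2)) (cong (b *_) (*-identityʳ b))

  pt-[1+k] : pt k (suc k) ≡ (suc k , suc k * b , c)
  pt-[1+k] = cong₂ _,_ (mod′-small (small (≤-trans 1+k≤b b≤b*b)))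
               (cong₂ _,_ (mod′-small (small (*-monoˡ-≤ b 1+k≤b)))
                          (trans (cong (_mod′ N) [1+k]b²≡c+N)
                                 (mod′-wrap (small (≤-trans (m≤m+n c e) (≤-reflexive (sym b*b≡c+e)))))))

  pair∈ : (pt k (suc k) , pt k 1) ∈ distinctPairs k
  pair∈ = ∈-distinctPairs⁺ k (small (≤-trans 1+k≤b b≤b*b)) (small (≤-trans 1≤b b≤b*b)) distinct
    where
    distinct : pt k (suc k) ≢ pt k 1
    distinct eq = ≢-nonZero⁻¹ k (suc-injective (cong proj₁ (trans (sym pt-[1+k]) (trans eq pt-1))))

  pair-sqDist : sqDist (pt k (suc k)) (pt k 1) ≡ 2 * k * k * M k
  pair-sqDist = begin
    sqDist (pt k (suc k)) (pt k 1)
      ≡⟨ cong₂ sqDist pt-[1+k] pt-1 ⟩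
    ∣ suc k - 1 ∣ ^ 2 + ∣ suc k * b - b ∣ ^ 2 + ∣ c - b * b ∣ ^ 2
      ≡⟨ cong₂ _+_ (cong₂ _+_ (cong (_^ 2) d₁) (cong (_^ 2) d₂)) (cong (_^ 2) d₃) ⟩
    k ^ 2 + (k * b) ^ 2 + e ^ 2
      ≡⟨ expand k ⟩
    2 * k * k * M k
      ∎
    where
    open ≡-Reasoning
    d₁ : ∣ suc k - 1 ∣ ≡ k
    d₁ = ∣-∣-identityʳ k
    d₂ : ∣ suc k * b - b ∣ ≡ k * b
    d₂ = trans (∣-∣-comm (b + k * b) b) (∣m-m+n∣≡n b (k * b))
    d₃ : ∣ c - b * b ∣ ≡ e
    d₃ = trans (cong (λ u → ∣ c - u ∣) b*b≡c+e) (∣m-m+n∣≡n c e)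
    expand : ∀ k → let b = 2 * k + 1 ; e = 2 * k * k + 2 * k in
      k * (k * 1) + k * b * (k * b * 1) + e * (e * 1) ≡ 2 * k * k * M k
    expand = solve-∀

lambdaStarSq≡ : ∀ k .{{_ : NonZero k}} → lambdaStarSq k ≡ 2 * k * k * M k
lambdaStarSq≡ k = minimum-map-≡ _ pair∈ pair-sqDist λ { {p , q} pq∈ → distinctPairs-far-apart k pq∈ }
  where open ClosestPair k

∣λ⁶-2N⁴∣ : ∀ k →
  ∣ + ((2 * k * k * M k) ^ 3) ℤ.- + (2 * (k * M k) ^ 4) ∣ ≡ 2 * (k * M k) ^ 3 * (k * (6 * k + 3))
∣λ⁶-2N⁴∣ k = trans (cong (λ u → ∣ + ((2 * k * k * M k) ^ 3) ℤ.- + u ∣) (expand k))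
                   (∣+m-+[m+n]∣≡n ((2 * k * k * M k) ^ 3) (2 * (k * M k) ^ 3 * (k * (6 * k + 3))))
  where
  expand : ∀ k → let c = 2 * k * k * M k ; N = k * M k in
    2 * (N * (N * (N * (N * 1)))) ≡ c * (c * (c * 1)) + 2 * (N * (N * (N * 1))) * (k * (6 * k + 3))
  expand = solve-∀

defect-bound : ∀ k p q .{{_ : NonZero k}} → 1 ≤ p → 3 * q ≤ k →
  q * (2 * (k * M k) ^ 3 * (k * (6 * k + 3))) < p * (k * M k) ^ 4
defect-bound k p q 1≤p 3q≤k = begin-strict
  q * (2 * N ^ 3 * (k * (6 * k + 3)))  ≡⟨ regroup-left q k N ⟩
  N ^ 3 * k * (3 * q * (4 * k + 2))    ≤⟨ *-monoʳ-≤ (N ^ 3 * k) (*-monoˡ-≤ (4 * k + 2) 3q≤k) ⟩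
  N ^ 3 * k * (k * (4 * k + 2))        <⟨ *-monoʳ-< (N ^ 3 * k) k[4k+2]<M ⟩
  N ^ 3 * k * M k                      ≤⟨ *-monoʳ-≤ (N ^ 3 * k) (m≤n*m (M k) p {{>-nonZero 1≤p}}) ⟩
  N ^ 3 * k * (p * M k)                ≡⟨ regroup-right p k ⟩
  p * N ^ 4                            ∎
  where
  open ≤-Reasoning
  N : ℕ
  N = k * M k
  instance
    N³k-nonZero : NonZero (N ^ 3 * k)
    N³k-nonZero = m*n≢0 (N ^ 3) k {{m^n≢0 N 3 {{m*n≢0 k (M k)}}}}
  k[4k+2]<M : k * (4 * k + 2) < M k
  k[4k+2]<M = ≤-trans (m≤m+n (suc (k * (4 * k + 2))) (4 * k + 2)) (≤-reflexive (expand k))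
    where
    expand : ∀ k → suc (k * (4 * k + 2)) + (4 * k + 2) ≡ M k
    expand = solve-∀
  regroup-left : ∀ q k N →
    q * (2 * (N * (N * (N * 1))) * (k * (6 * k + 3))) ≡ N * (N * (N * 1)) * k * (3 * q * (4 * k + 2))
  regroup-left = solve-∀
  regroup-right : ∀ p k → let N = k * M k in
    N * (N * (N * 1)) * k * (p * M k) ≡ p * (N * (N * (N * (N * 1))))
  regroup-right = solve-∀

theorem3 : (p q : ℕ) → 1 ≤ p → 1 ≤ q →
    Σ ℕ (λ K → (k : ℕ) → 1 ≤ k → K ≤ k →
      q * ∣ (+ (lambdaStarSq k ^ 3)) ℤ.- (+ (2 * NOf k ^ 4)) ∣ < p * NOf k ^ 4)
theorem3 p q 1≤p _ = 3 * q , bound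
  where
  bound : (k : ℕ) → 1 ≤ k → 3 * q ≤ k →
    q * ∣ + (lambdaStarSq k ^ 3) ℤ.- + (2 * NOf k ^ 4) ∣ < p * NOf k ^ 4
  bound k 1≤k 3q≤k = begin-strict
    q * ∣ + (lambdaStarSq k ^ 3) ℤ.- + (2 * NOf k ^ 4) ∣
      ≡⟨ cong₂ (λ λ² N → q * ∣ + (λ² ^ 3) ℤ.- + (2 * N ^ 4) ∣) (lambdaStarSq≡ k) (NOf≡k*M k) ⟩
    q * ∣ + ((2 * k * k * M k) ^ 3) ℤ.- + (2 * (k * M k) ^ 4) ∣
      ≡⟨ cong (q *_) (∣λ⁶-2N⁴∣ k) ⟩
    q * (2 * (k * M k) ^ 3 * (k * (6 * k + 3)))
      <⟨ defect-bound k p q 1≤p 3q≤k ⟩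
    p * (k * M k) ^ 4
      ≡⟨ cong (λ N → p * N ^ 4) (NOf≡k*M k) ⟨
    p * NOf k ^ 4
      ∎
    where
    open ≤-Reasoning
    instance
      k-nonZero : NonZero k
      k-nonZero = >-nonZero 1≤k
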